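{- Let $s,t\in\mathbb{R}$ with $s\neq0$, $t\neq0$, $s^2+4t\neq0$, and let $q$ be a parameter. For all $n\in\mathbb{N}$, \[ \Theta_0^{(n)}(x,q)=\{n\}_{s,t}!\,q^{\binom{n}{2}}\,(1\oplus_{1,-tq}(-tq)^n t x)^{(-n-1)}_{s,t} =\{n\}_{s,t}!\,q^{\binom{n}{2}}\sum_{d=0}^{\infty}\genfrac{\{}{\}}{0pt}{}{ -n-1}{d}_{s,t}(-tq)^{\binom{d}{2}}\big((-tq)^n t x\big)^d . \]
   Context: The Partial Theta function is $\Theta_0(x,q)=\sum_{n\geq0}q^{\binom{n}{2}}x^n$, and $\Theta_0^{(n)}(x,q)=\mathbf{D}^n_{s,t}\Theta_0(x,q)$, the $n$-fold $(s,t)$-derivative in $x$. Here $\varphi_{s,t}=\frac{s+\sqrt{s^2+4t}}{2}$, $\varphi'_{s,t}=\frac{s-\sqrt{s^2+4t}}{2}$, $(\mathbf{D}_{s,t}f)(x)=\frac{f(\varphi_{s,t}x)-f(\varphi'_{s,t}x)}{(\varphi_{s,t}-\varphi'_{s,t})x}$ for $x\neq0$ and $f'(0)$ at $x=0$ (applied termwise to power series). For $\alpha\in\mathbb{C}$, $\{\alpha\}_{s,t}=\frac{\varphi_{s,t}^{\alpha}-\varphi_{s,t}'^{\alpha}}{\varphi_{s,t}-\varphi'_{s,t}}$; for integers these are the generalized Fibonacci polynomials ($\{0\}=0,\{1\}=1,\{n+2\}=s\{n+1\}+t\{n\}$); $\{k\}_{s,t}!=\{1\}_{s,t}\cdots\{k\}_{s,t}$;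 $\genfrac{\{}{\}}{0pt}{}{\alpha}{k}_{s,t}=\frac{\{\alpha\}_{s,t}\cdots\{\alpha-k+1\}_{s,t}}{\{k\}_{s,t}!}$. The deformed binomial series is $(x\oplus_{u,v}y)^{(\alpha)}_{s,t}=\sum_{n\geq0}\genfrac{\{}{\}}{0pt}{}{\alpha}{n}_{s,t}u^{\binom{\alpha-n}{2}}v^{\binom{n}{2}}x^{\alpha-n}y^n$. -}

module Defs where

open import Level using (Level)
open import Data.Nat using (ℕ; zero; suc)
open import Data.Nat.Combinatorics using (_C_)
open import Data.Integer using (ℤ; +_; -[1+_])
open import Algebra.Bundles using (CommutativeRing)

-- All notions are defined over an arbitrary commutative ring R, with
-- parameters s, t, q ∈ R and a chosen inverse tinv of t.
module FibOps {c ℓ : Level} (R : CommutativeRing c ℓ) where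
  open CommutativeRing R hiding (zero)

  pow : Carrier → ℕ → Carrier
  pow x zero    = 1#
  pow x (suc k) = x * pow x k

  powℤ : Carrier → Carrier → ℤ → Carrier
  powℤ x xinv (+ k)      = pow x k
  powℤ x xinv -[1+ k ]   = pow xinv (suc k)

  -- binomial coefficient (m choose 2) for an integer m; it is always a
  -- natural number:  m(m-1)/2.  For m = -(k+1) it equals (k+2)(k+1)/2.
  choose2ℤ : ℤ → ℕ
  choose2ℤ (+ k)    = k C 2
  choose2ℤ -[1+ k ] = suc (suc k) C 2

  module _ (s t tinv : Carrier) where

    fib : ℕ → Carrier
    fib zero          = 0#
    fib (suc zero)    = 1#
    fib (suc (suc n)) = s * fib (suc n) + t * fib n

    -- the same recurrence run backwards: {n} = t⁻¹ ({n+2} - s {n+1}).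
    -- fibNeg k = {-(k+1)}_{s,t}
    fibNeg : ℕ → Carrier
    fibNeg zero          = tinv * (fib 1 - s * fib 0)
    fibNeg (suc zero)    = tinv * (fib 0 - s * fibNeg zero)
    fibNeg (suc (suc k)) = tinv * (fibNeg k - s * fibNeg (suc k))

    fibℤ : ℤ → Carrier
    fibℤ (+ n)     = fib n
    fibℤ -[1+ k ]  = fibNeg k

    fibFact : ℕ → Carrier
    fibFact zero    = 1#
    fibFact (suc k) = fibFact k * fib (suc k)

    fallingFib : ℤ → ℕ → Carrier
    fallingFib α zero    = 1#
    fallingFib α (suc k) = fallingFib α k * fibℤ (α Data.Integer.- (+ k))

    -- generalized binomial {α choose k}_{s,t}, where w is an inverse of {k}_{s,t}!
    genBinom : ℤ → (k : ℕ) → (w : Carrier) → Carrier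
    genBinom α k w = fallingFib α k * w

    -- (s,t)-derivative acting termwise on a power series (coefficient sequence):
    -- D x^m = {m} x^(m-1), so (D f)_m = {m+1} f_(m+1)
    D : (ℕ → Carrier) → (ℕ → Carrier)
    D f m = fib (suc m) * f (suc m)

    Dⁿ : ℕ → (ℕ → Carrier) → (ℕ → Carrier)
    Dⁿ zero    f = f
    Dⁿ (suc n) f = D (Dⁿ n f)

    -- Partial theta function Θ₀(x,q) = Σ q^(n choose 2) x^n, as coefficient sequence
    Θ₀ : Carrier → ℕ → Carrier
    Θ₀ q m = pow q (m C 2)

    Θ₀⁽_⁾ : ℕ → Carrier → ℕ → Carrier
    Θ₀⁽ n ⁾ q = Dⁿ n (Θ₀ q)

    -- deformed binomial series (x ⊕_{u,v} y)^{(α)} with y = c·z, as a power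
    -- series in z: coefficient of z^d is
    --   {α choose d} u^{C(α-d,2)} v^{C(d,2)} x^{α-d} c^d ,
    -- where xinv is an inverse of x and w an inverse of {d}!.
    deformedBinomCoeff : (u v x xinv c : Carrier) → ℤ → (d : ℕ) → (w : Carrier) → Carrier
    deformedBinomCoeff u v x xinv c α d w =
      genBinom α d w * pow u (choose2ℤ (α Data.Integer.- (+ d))) * pow v (d C 2)
        * powℤ x xinv (α Data.Integer.- (+ d)) * pow c d

-- Coefficientwise, the d-th coefficient of D^n Θ₀ is {d+1}⋯{d+n} q^C(n+d,2),
-- so {d}! times it is L(n+d), where L(m) = {m}! q^C(m,2) is the leading
-- coefficient of Θ₀^(m) and L(m+1) = L(m) · q^m {m+1}.  Running the Fibonacci
-- recurrence backwards gives {-(m+1)} (-t)^(m+1) = -{m+1}, and with it the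
-- d-th term B(d) of the deformed binomial series obeys the same recurrence
-- B(d+1) = B(d) · q^(n+d) {n+d+1}, with B(0) = 1.  Hence L(n) B(d) = L(n+d),
-- and dividing by {d}! gives the theorem.
module Submission where

open import Defs
open import Level using (Level)
open import Data.Nat as ℕ using (ℕ; zero; suc)
import Data.Nat.Properties as ℕₚ
open import Data.Nat.Combinatorics using (_C_; nC1≡n; nCk+nC[k+1]≡[n+1]C[k+1])
open import Data.Integer as ℤ using (ℤ; +_; -[1+_])
open import Data.Product using (_×_; _,_)
open import Relation.Nullary using (¬_)
import Relation.Binary.PropositionalEquality as ≡
open ≡ using (_≡_; cong; cong₂)
open import Algebra.Bundles using (CommutativeRing)

[1+n]C2≡n+nC2 : ∀ n → suc n C 2 ≡ n ℕ.+ n C 2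
[1+n]C2≡n+nC2 n = ≡.trans (≡.sym (nCk+nC[k+1]≡[n+1]C[k+1] n 1)) (cong (ℕ._+ n C 2) (nC1≡n n))

-[1+n]-d≡-[1+n+d] : ∀ n d → -[1+ n ] ℤ.- + d ≡ -[1+ (n ℕ.+ d) ]
-[1+n]-d≡-[1+n+d] n zero    = cong -[1+_] (≡.sym (ℕₚ.+-identityʳ n))
-[1+n]-d≡-[1+n+d] n (suc d) = cong -[1+_] (≡.sym (ℕₚ.+-suc n d))

module CommutativeRingProperties {c ℓ : Level} (R : CommutativeRing c ℓ) where
  open CommutativeRing R hiding (zero)
  open FibOps R
  open import Algebra.Properties.Ring ring
  open import Algebra.Properties.Semiring.Exp semiring using (_^_; ^-homo-*)
  open import Algebra.Properties.CommutativeSemiring.Exp commutativeSemiring using (^-distrib-*)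
  open import Algebra.Solver.Ring.NaturalCoefficients.Default commutativeSemiring
    using (solve; _:*_; _:+_; _:=_; con)
  open import Relation.Binary.Reasoning.Setoid setoid

  pow≡^ : ∀ x k → pow x k ≡ x ^ k
  pow≡^ x zero    = ≡.refl
  pow≡^ x (suc k) = cong (x *_) (pow≡^ x k)

  pow-cong : ∀ {x y} k → x ≈ y → pow x k ≈ pow y k
  pow-cong zero    x≈y = refl
  pow-cong (suc k) x≈y = *-cong x≈y (pow-cong k x≈y)

  pow-+ : ∀ x m n → pow x (m ℕ.+ n) ≈ pow x m * pow x n
  pow-+ x m n = begin
    pow x (m ℕ.+ n)    ≡⟨ pow≡^ x (m ℕ.+ n) ⟩
    x ^ (m ℕ.+ n)      ≈⟨ ^-homo-* x m n ⟩
    x ^ m * x ^ n      ≡⟨ cong₂ _*_ (pow≡^ x m) (pow≡^ x n) ⟨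
    pow x m * pow x n  ∎

  pow-distrib-* : ∀ x y k → pow (x * y) k ≈ pow x k * pow y k
  pow-distrib-* x y k = begin
    pow (x * y) k      ≡⟨ pow≡^ (x * y) k ⟩
    (x * y) ^ k        ≈⟨ ^-distrib-* x y k ⟩
    x ^ k * y ^ k      ≡⟨ cong₂ _*_ (pow≡^ x k) (pow≡^ y k) ⟨
    pow x k * pow y k  ∎

  pow-1# : ∀ k → pow 1# k ≈ 1#
  pow-1# zero    = refl
  pow-1# (suc k) = trans (*-identityˡ _) (pow-1# k)

  powℤ-1# : ∀ z → powℤ 1# 1# z ≈ 1#
  powℤ-1# (+ k)    = pow-1# k
  powℤ-1# -[1+ k ] = pow-1# (suc k)

  -- The solver below works over the commutative semiring, so negation is
  -- handled by treating ν = -1 as an atom and using ν * ν ≈ 1.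
  ν : Carrier
  ν = - 1#

  ν*ν≈1 : ν * ν ≈ 1#
  ν*ν≈1 = trans (-1*x≈-x (- 1#)) (-‿involutive 1#)

  -x≈ν*x : ∀ x → - x ≈ ν * x
  -x≈ν*x x = sym (-1*x≈-x x)

  *-cancel-unitˡ : ∀ {a b} x → a * b ≈ 1# → a * b * x ≈ x
  *-cancel-unitˡ x ab≈1 = trans (*-congʳ ab≈1) (*-identityˡ x)

  module Fibonacci (s t tinv : Carrier) (t*tinv≈1 : t * tinv ≈ 1#) where

    F : ℕ → Carrier
    F = fib s t tinv

    F₋ : ℕ → Carrier
    F₋ = fibNeg s t tinv

    F! : ℕ → Carrier
    F! = fibFact s t tinv

    fibNeg-step : ∀ {k a} X Y →
                  X * pow (- t) k ≈ - F a →
                  Y * pow (- t) (suc k) ≈ - F (suc a) →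
                  tinv * (X - s * Y) * pow (- t) (suc (suc k)) ≈ - F (suc (suc a))
    fibNeg-step {k} {a} X Y hX hY = begin
      tinv * (X - s * Y) * (- t * (- t * p))
        ≈⟨ *-cong (*-congˡ (+-congˡ (-x≈ν*x (s * Y)))) (*-cong (-x≈ν*x t) (*-congʳ (-x≈ν*x t))) ⟩
      tinv * (X + ν * (s * Y)) * (ν * t * (ν * t * p))
        ≈⟨ solve 7 (λ ti t ν s X Y p →
                      ti :* (X :+ ν :* (s :* Y)) :* (ν :* t :* (ν :* t :* p))
                   := t :* ti :* (ν :* ν) :* (s :* (Y :* (ν :* t :* p)) :+ t :* (X :* p)))
                 refl tinv t ν s X Y p ⟩
      t * tinv * (ν * ν) * (s * (Y * (ν * t * p)) + t * (X * p))
        ≈⟨ trans (*-assoc _ _ _) (*-cancel-unitˡ _ t*tinv≈1) ⟩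
      ν * ν * (s * (Y * (ν * t * p)) + t * (X * p))
        ≈⟨ *-cancel-unitˡ _ ν*ν≈1 ⟩
      s * (Y * (ν * t * p)) + t * (X * p)
        ≈⟨ +-cong (*-congˡ (*-congˡ (*-congʳ (-x≈ν*x t)))) (*-congˡ (sym hX)) ⟨
      s * (Y * pow (- t) (suc k)) + t * - F a
        ≈⟨ +-congʳ (*-congˡ hY) ⟩
      s * - F (suc a) + t * - F a
        ≈⟨ +-cong (-‿distribʳ-* s _) (-‿distribʳ-* t _) ⟨
      - (s * F (suc a)) + - (t * F a)
        ≈⟨ -‿+-comm _ _ ⟩
      - F (suc (suc a)) ∎
      where
        p : Carrier
        p = pow (- t) k

    fibNeg*pow-t : ∀ m → F₋ m * pow (- t) (suc m) ≈ - F (suc m)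
    fibNeg*pow-t zero = begin
      tinv * (1# - s * 0#) * (- t * 1#)
        ≈⟨ *-cong (*-congˡ (+-congˡ (-x≈ν*x (s * 0#)))) (*-congʳ (-x≈ν*x t)) ⟩
      tinv * (1# + ν * (s * 0#)) * (ν * t * 1#)
        ≈⟨ solve 4 (λ ti t ν s → ti :* (con 1 :+ ν :* (s :* con 0)) :* (ν :* t :* con 1)
                                := t :* ti :* ν)
                 refl tinv t ν s ⟩
      t * tinv * ν
        ≈⟨ *-cancel-unitˡ ν t*tinv≈1 ⟩
      - 1# ∎
    fibNeg*pow-t (suc zero) =
      fibNeg-step {0} {0} (F 0) (F₋ 0) (trans (zeroˡ 1#) (sym -0#≈0#)) (fibNeg*pow-t 0)
    fibNeg*pow-t (suc (suc k)) =
      fibNeg-step {suc k} {suc k} (F₋ k) (F₋ (suc k)) (fibNeg*pow-t k) (fibNeg*pow-t (suc k))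

    risingFib : ℕ → ℕ → Carrier
    risingFib d zero    = 1#
    risingFib d (suc n) = F (suc d) * risingFib (suc d) n

    Dⁿ-coeff : ∀ n f d → Dⁿ s t tinv n f d ≈ risingFib d n * f (n ℕ.+ d)
    Dⁿ-coeff zero    f d = sym (*-identityˡ (f d))
    Dⁿ-coeff (suc n) f d = begin
      F (suc d) * Dⁿ s t tinv n f (suc d)                  ≈⟨ *-congˡ (Dⁿ-coeff n f (suc d)) ⟩
      F (suc d) * (risingFib (suc d) n * f (n ℕ.+ suc d))  ≈⟨ *-assoc _ _ _ ⟨
      risingFib d (suc n) * f (n ℕ.+ suc d)                ≡⟨ cong (λ m → risingFib d (suc n) * f m) (ℕₚ.+-suc n d) ⟩
      risingFib d (suc n) * f (suc n ℕ.+ d)                ∎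

    fibFact*risingFib : ∀ n d → F! d * risingFib d n ≈ F! (n ℕ.+ d)
    fibFact*risingFib zero    d = *-identityʳ (F! d)
    fibFact*risingFib (suc n) d = begin
      F! d * (F (suc d) * risingFib (suc d) n)  ≈⟨ *-assoc _ _ _ ⟨
      F! (suc d) * risingFib (suc d) n          ≈⟨ fibFact*risingFib n (suc d) ⟩
      F! (n ℕ.+ suc d)                          ≡⟨ cong F! (ℕₚ.+-suc n d) ⟩
      F! (suc n ℕ.+ d)                          ∎

    deformedBinomCoeff-unit : ∀ v c α d w →
      deformedBinomCoeff s t tinv 1# v 1# 1# c α d w ≈ genBinom s t tinv α d w * pow v (d C 2) * pow c d
    deformedBinomCoeff-unit v c α d w = begin
      g * pow 1# (choose2ℤ (α ℤ.- + d)) * b * powℤ 1# 1# (α ℤ.- + d) * e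
        ≈⟨ *-congʳ (*-cong (*-congʳ (*-congˡ (pow-1# (choose2ℤ (α ℤ.- + d))))) (powℤ-1# (α ℤ.- + d))) ⟩
      g * 1# * b * 1# * e
        ≈⟨ solve 3 (λ g b e → g :* con 1 :* b :* con 1 :* e := g :* b :* e) refl g b e ⟩
      g * b * e ∎
      where
        g b e : Carrier
        g = genBinom s t tinv α d w
        b = pow v (d C 2)
        e = pow c d

    module Theta (q : Carrier) where

      thetaLead : ℕ → Carrier
      thetaLead m = F! m * pow q (m C 2)

      thetaLead-suc : ∀ m → thetaLead (suc m) ≈ thetaLead m * (pow q m * F (suc m))
      thetaLead-suc m = begin
        F! m * F (suc m) * pow q (suc m C 2)          ≡⟨ cong (λ k → F! m * F (suc m) * pow q k) ([1+n]C2≡n+nC2 m) ⟩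
        F! m * F (suc m) * pow q (m ℕ.+ m C 2)        ≈⟨ *-congˡ (pow-+ q m (m C 2)) ⟩
        F! m * F (suc m) * (pow q m * pow q (m C 2))
          ≈⟨ solve 4 (λ a b c e → a :* b :* (c :* e) := a :* e :* (c :* b))
                   refl (F! m) (F (suc m)) (pow q m) (pow q (m C 2)) ⟩
        thetaLead m * (pow q m * F (suc m))           ∎

      fibFact*Θ₀-coeff : ∀ n d → F! d * Θ₀⁽_⁾ s t tinv n q d ≈ thetaLead (n ℕ.+ d)
      fibFact*Θ₀-coeff n d = begin
        F! d * Θ₀⁽_⁾ s t tinv n q d                     ≈⟨ *-congˡ (Dⁿ-coeff n (Θ₀ s t tinv q) d) ⟩
        F! d * (risingFib d n * pow q ((n ℕ.+ d) C 2))  ≈⟨ *-assoc _ _ _ ⟨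
        F! d * risingFib d n * pow q ((n ℕ.+ d) C 2)    ≈⟨ *-congʳ (fibFact*risingFib n d) ⟩
        thetaLead (n ℕ.+ d)                             ∎

      module DeformedBinomial (n : ℕ) where

        α : ℤ
        α = -[1+ n ]

        v : Carrier
        v = - (t * q)

        cc : Carrier
        cc = pow v n * t

        binomTerm : ℕ → Carrier
        binomTerm d = fallingFib s t tinv α d * pow v (d C 2) * pow cc d

        fibNeg*pow-v : ∀ m → F₋ m * pow v m * t ≈ pow q m * F (suc m)
        fibNeg*pow-v m = begin
          F₋ m * pow v m * t                           ≈⟨ *-congʳ (*-congˡ (pow-cong m (-‿distribˡ-* t q))) ⟩
          F₋ m * pow (- t * q) m * t                   ≈⟨ *-congʳ (*-congˡ (pow-distrib-* (- t) q m)) ⟩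
          F₋ m * (pow (- t) m * pow q m) * t
            ≈⟨ solve 4 (λ f p r t → f :* (p :* r) :* t := f :* (t :* p) :* r)
                     refl (F₋ m) (pow (- t) m) (pow q m) t ⟩
          F₋ m * (t * pow (- t) m) * pow q m           ≈⟨ *-congʳ (*-congˡ t*p≈-[-t*p]) ⟩
          F₋ m * - pow (- t) (suc m) * pow q m         ≈⟨ *-congʳ (-‿distribʳ-* _ _) ⟨
          - (F₋ m * pow (- t) (suc m)) * pow q m       ≈⟨ *-congʳ (-‿cong (fibNeg*pow-t m)) ⟩
          - - F (suc m) * pow q m                      ≈⟨ *-congʳ (-‿involutive _) ⟩
          F (suc m) * pow q m                          ≈⟨ *-comm _ _ ⟩
          pow q m * F (suc m)                          ∎
          where
            t*p≈-[-t*p] : t * pow (- t) m ≈ - (- t * pow (- t) m)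
            t*p≈-[-t*p] = sym (trans (-‿cong (sym (-‿distribˡ-* t _))) (-‿involutive _))

        binomTerm-suc : ∀ d → binomTerm (suc d) ≈ binomTerm d * (pow q (n ℕ.+ d) * F (suc (n ℕ.+ d)))
        binomTerm-suc d = begin
          a * fibℤ s t tinv (α ℤ.- + d) * pow v (suc d C 2) * (cc * pow cc d)
            ≡⟨ cong₂ (λ z k → a * fibℤ s t tinv z * pow v k * (cc * pow cc d))
                     (-[1+n]-d≡-[1+n+d] n d) ([1+n]C2≡n+nC2 d) ⟩
          a * F₋ (n ℕ.+ d) * pow v (d ℕ.+ d C 2) * (pow v n * t * pow cc d)
            ≈⟨ *-congʳ (*-congˡ (pow-+ v d (d C 2))) ⟩
          a * F₋ (n ℕ.+ d) * (pow v d * b) * (pow v n * t * pow cc d)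
            ≈⟨ solve 7 (λ a f vd b vn t e → a :* f :* (vd :* b) :* (vn :* t :* e)
                                          := a :* b :* e :* (f :* (vn :* vd) :* t))
                     refl a (F₋ (n ℕ.+ d)) (pow v d) b (pow v n) t (pow cc d) ⟩
          binomTerm d * (F₋ (n ℕ.+ d) * (pow v n * pow v d) * t)
            ≈⟨ *-congˡ (*-congʳ (*-congˡ (pow-+ v n d))) ⟨
          binomTerm d * (F₋ (n ℕ.+ d) * pow v (n ℕ.+ d) * t)
            ≈⟨ *-congˡ (fibNeg*pow-v (n ℕ.+ d)) ⟩
          binomTerm d * (pow q (n ℕ.+ d) * F (suc (n ℕ.+ d))) ∎
          where
            a b : Carrier
            a = fallingFib s t tinv α d
            b = pow v (d C 2)

        thetaLead*binomTerm : ∀ d → thetaLead n * binomTerm d ≈ thetaLead (n ℕ.+ d)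
        thetaLead*binomTerm zero = begin
          thetaLead n * (1# * 1# * 1#)  ≈⟨ *-congˡ (trans (*-identityʳ _) (*-identityʳ 1#)) ⟩
          thetaLead n * 1#              ≈⟨ *-identityʳ _ ⟩
          thetaLead n                   ≡⟨ cong thetaLead (ℕₚ.+-identityʳ n) ⟨
          thetaLead (n ℕ.+ 0)           ∎
        thetaLead*binomTerm (suc d) = begin
          thetaLead n * binomTerm (suc d)  ≈⟨ *-congˡ (binomTerm-suc d) ⟩
          thetaLead n * (binomTerm d * r)  ≈⟨ *-assoc _ _ _ ⟨
          thetaLead n * binomTerm d * r    ≈⟨ *-congʳ (thetaLead*binomTerm d) ⟩
          thetaLead (n ℕ.+ d) * r          ≈⟨ thetaLead-suc (n ℕ.+ d) ⟨
          thetaLead (suc (n ℕ.+ d))        ≡⟨ cong thetaLead (ℕₚ.+-suc n d) ⟨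
          thetaLead (n ℕ.+ suc d)          ∎
          where
            r : Carrier
            r = pow q (n ℕ.+ d) * F (suc (n ℕ.+ d))

mainTheorem3 : {c ℓ : Level} (R : CommutativeRing c ℓ) →
    let open CommutativeRing R
        open FibOps R
    in (s t q tinv : Carrier) →
       ¬ (s ≈ 0#) → ¬ (t ≈ 0#) → ¬ (s * s + (1# + 1# + 1# + 1#) * t ≈ 0#) →
       t * tinv ≈ 1# →
       (n d : ℕ) → (w : Carrier) → w * fibFact s t tinv d ≈ 1# →
       let α = -[1+ n ]
           v = - (t * q)
           cc = pow v n * t
           lead = fibFact s t tinv n * pow q (n C 2)
       in (Θ₀⁽_⁾ s t tinv n q d ≈ lead * deformedBinomCoeff s t tinv 1# v 1# 1# cc α d w)
          × (Θ₀⁽_⁾ s t tinv n q d ≈ lead * (genBinom s t tinv α d w * pow v (d C 2) * pow cc d))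
-- The non-degeneracy hypotheses on s, t and s² + 4t are only needed for the
-- analytic reading of the series; the coefficient identity holds without them.
mainTheorem3 R s t q tinv _ _ _ t*tinv≈1 n d w w*d!≈1 = deformedForm , explicitForm
  where
  open CommutativeRing R hiding (zero)
  open FibOps R
  open CommutativeRingProperties R
  open Fibonacci s t tinv t*tinv≈1
  open Theta q
  open DeformedBinomial n
  open import Relation.Binary.Reasoning.Setoid setoid
  open import Algebra.Solver.Ring.NaturalCoefficients.Default commutativeSemiring
    using (solve; _:*_; _:=_)

  explicitForm : Θ₀⁽_⁾ s t tinv n q d ≈ thetaLead n * (genBinom s t tinv α d w * pow v (d C 2) * pow cc d)
  explicitForm = begin
    Θ₀⁽_⁾ s t tinv n q d             ≈⟨ *-cancel-unitˡ _ w*d!≈1 ⟨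
    w * F! d * Θ₀⁽_⁾ s t tinv n q d  ≈⟨ trans (*-assoc _ _ _) (*-congˡ (fibFact*Θ₀-coeff n d)) ⟩
    w * thetaLead (n ℕ.+ d)          ≈⟨ *-congˡ (thetaLead*binomTerm d) ⟨
    w * (thetaLead n * binomTerm d)
      ≈⟨ solve 5 (λ w L a b e → w :* (L :* (a :* b :* e)) := L :* (a :* w :* b :* e))
               refl w (thetaLead n) (fallingFib s t tinv α d) (pow v (d C 2)) (pow cc d) ⟩
    thetaLead n * (genBinom s t tinv α d w * pow v (d C 2) * pow cc d) ∎

  deformedForm : Θ₀⁽_⁾ s t tinv n q d ≈ thetaLead n * deformedBinomCoeff s t tinv 1# v 1# 1# cc α d w
  deformedForm = trans explicitForm (*-congˡ (sym (deformedBinomCoeff-unit v cc α d w)))
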